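{- Let $\mathbf{n}=(n_1,\dots,n_s)\in\mathbb{N}_+^s$ and $\ell\in\{1,\dots,s\}$. Then $A_{\mathbf{n}+\mathbf{e}_\ell}=M_{\mathbf{n},\ell}A_\mathbf{n}$, where $M_{\mathbf{n},\ell}$ is the $s\times s$ matrix whose $(k,j)$ entry is $n_j+\delta_{kj}(\alpha_k-\alpha_\ell)$ (with $\delta_{kj}$ the Kronecker symbol), i.e. \[ M_{\mathbf{n},\ell}=\begin{pmatrix}n_1+(\alpha_1-\alpha_\ell)&n_2&\cdots&n_s\\ n_1&n_2+(\alpha_2-\alpha_\ell)&\cdots&n_s\\ \vdots&\vdots&\ddots&\vdots\\ n_1&n_2&\cdots&n_s+(\alpha_s-\alpha_\ell)\end{pmatrix}. \]
   Context: $\mathbb{N}=\{0,1,2,\dots\}$, $\mathbb{N}_+=\mathbb{N}\setminus\{0\}$. $K$ is a number field, $\alpha_1,\dots,\alpha_s\in K$ distinct, $\mathbf{e}_1,\dots,\mathbf{e}_s$ the standard basis of $\mathbb{Z}^s$. For $\mathbf{n}\in\mathbb{N}^s$: $f_\mathbf{n}(z)=\prod_i(z-\alpha_i)^{n_i}$, $N=\sum_in_i$, $P_\mathbf{n}=\sum_{k=0}^Nf_\mathbf{n}^{(k)}$, $a_\mathbf{n}=(P_\mathbf{n}(\alpha_1),\dots,P_\mathbf{n}(\alpha_s))\in K^s$. For $\mathbf{n}\in\mathbb{N}_+^s$, $A_\mathbf{n}$ is the $s\times s$ matrix whose $\ell$-th row is $a_{\mathbf{n}-\mathbf{e}_\ell}$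 for $\ell=1,\dots,s$. -}

module Defs where

open import Level using (Level)
open import Algebra.Bundles using (CommutativeRing)
open import Data.Nat using (ℕ; zero; suc; _∸_)
open import Data.Fin using (Fin; _≟_)
open import Data.List using (List; []; _∷_; foldr; map; upTo; allFin)
open import Relation.Nullary using (yes; no)

module _ {c ℓ : Level} (R : CommutativeRing c ℓ) where
  open CommutativeRing R

  fromℕ : ℕ → Carrier
  fromℕ zero = 0#
  fromℕ (suc n) = 1# + fromℕ n

  -- polynomials as coefficient lists, lowest degree first
  Poly : Set c
  Poly = List Carrier

  padd : Poly → Poly → Poly
  padd [] q = q
  padd (a ∷ p) [] = a ∷ p
  padd (a ∷ p) (b ∷ q) = (a + b) ∷ padd p q

  pscale : Carrier → Poly → Poly
  pscale a p = map (a *_) p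

  pmul : Poly → Poly → Poly
  pmul [] q = []
  pmul (a ∷ p) q = padd (pscale a q) (0# ∷ pmul p q)

  pone : Poly
  pone = 1# ∷ []

  ppow : Poly → ℕ → Poly
  ppow p zero = pone
  ppow p (suc k) = pmul p (ppow p k)

  linear : Carrier → Poly
  linear a = (- a) ∷ 1# ∷ []

  derivFrom : ℕ → Poly → Poly
  derivFrom k [] = []
  derivFrom k (b ∷ q) = (fromℕ k * b) ∷ derivFrom (suc k) q

  deriv : Poly → Poly
  deriv [] = []
  deriv (a ∷ p) = derivFrom 1 p

  derivN : ℕ → Poly → Poly
  derivN zero p = p
  derivN (suc k) p = deriv (derivN k p)

  eval : Poly → Carrier → Carrier
  eval [] x = 0#
  eval (a ∷ p) x = a + x * eval p x

  ΣFin : ∀ {s} → (Fin s → Carrier) → Carrier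
  ΣFin {s} g = foldr (λ i acc → g i + acc) 0# (allFin s)

  module _ {s : ℕ} (α : Fin s → Carrier) where

    total : (Fin s → ℕ) → ℕ
    total n = foldr (λ i acc → Data.Nat._+_ (n i) acc) 0 (allFin s)

    fpoly : (Fin s → ℕ) → Poly
    fpoly n = foldr (λ i acc → pmul (ppow (linear (α i)) (n i)) acc) pone (allFin s)

    Ppoly : (Fin s → ℕ) → Poly
    Ppoly n = foldr padd [] (map (λ k → derivN k (fpoly n)) (upTo (suc (total n))))

    avec : (Fin s → ℕ) → Fin s → Carrier
    avec n j = eval (Ppoly n) (α j)

    -- n + e_l and n - e_l (the latter used only for n ∈ ℕ_+^s)
    plusE : (Fin s → ℕ) → Fin s → Fin s → ℕ
    plusE n l i with i ≟ l
    ... | yes _ = suc (n i)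
    ... | no _ = n i

    minusE : (Fin s → ℕ) → Fin s → Fin s → ℕ
    minusE n l i with i ≟ l
    ... | yes _ = n i ∸ 1
    ... | no _ = n i

    Amat : (Fin s → ℕ) → Fin s → Fin s → Carrier
    Amat n r j = avec (minusE n r) j

    δ : Fin s → Fin s → Carrier
    δ k j with k ≟ j
    ... | yes _ = 1#
    ... | no _ = 0#

    Mmat : (Fin s → ℕ) → Fin s → Fin s → Fin s → Carrier
    Mmat n l k j = fromℕ (n j) + δ k j * (α k - α l)

    matMul : (Fin s → Fin s → Carrier) → (Fin s → Fin s → Carrier) → Fin s → Fin s → Carrier
    matMul X Y k j = ΣFin (λ m → X k m * Y m j)

{-# OPTIONS --safe #-}
-- Write fᵥ = ∏ᵢ (z − αᵢ)^{vᵢ}; then P_v(x) = Σ_k fᵥ^{(k)}(x), where the sum may run to any order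
-- beyond deg fᵥ. Row k of A_{n+e_ℓ} is a_{n+e_ℓ−e_k}, and two facts compute it.
-- (1) f_{n+e_ℓ−e_k} = (z − α_ℓ) f_{n−e_k} = f_n + (α_k − α_ℓ) f_{n−e_k}, so by linearity of f ↦ Σ_k f^{(k)}(x)
--     a_{n+e_ℓ−e_k} = a_n + (α_k − α_ℓ) a_{n−e_k}.
-- (2) P_v(x) = fᵥ(x) + Σ_k (fᵥ′)^{(k)}(x) and f_n′ = Σ_m n_m f_{n−e_m} (Leibniz rule); since f_n
--     vanishes at every α_j, a_n = Σ_m n_m a_{n−e_m}.
-- Substituting (2) into (1) gives exactly row k of M_{n,ℓ} A_n.
module Submission where

open import Algebra.Bundles using (CommutativeRing; CommutativeMonoid)
open import Data.Fin using (Fin; _≟_)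
open import Data.List using (List; []; _∷_; foldr; map; applyUpTo; upTo; allFin)
import Data.List.Properties as List
open import Data.List.Membership.Propositional using (_∈_)
open import Data.List.Membership.Propositional.Properties using (∈-allFin)
open import Data.List.Relation.Unary.All as All using (All; []; _∷_)
open import Data.List.Relation.Unary.Any using (here; there)
open import Data.List.Relation.Unary.AllPairs using ([]; _∷_)
open import Data.List.Relation.Unary.Unique.Propositional using (Unique)
open import Data.List.Relation.Unary.Unique.Propositional.Properties using (allFin⁺)
open import Data.Nat using (ℕ; zero; suc; _≤_; _<_; _∸_; z≤n; s≤s)
import Data.Nat as ℕ
import Data.Nat.Properties as ℕ
open import Data.Product using (_,_)
open import Data.Sum using (inj₁; inj₂)
open import Relation.Binary.Bundles using (Setoid)
import Relation.Binary.Reasoning.Setoid as SetoidReasoning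
open import Relation.Binary.PropositionalEquality as ≡ using (_≡_; _≢_)
open import Relation.Nullary using (¬_; Dec; yes; no; contradiction)

open import Defs

applyUpTo-cong : ∀ {a} {A : Set a} {f g : ℕ → A} → (∀ k → f k ≡ g k) → ∀ n → applyUpTo f n ≡ applyUpTo g n
applyUpTo-cong f≡g zero    = ≡.refl
applyUpTo-cong f≡g (suc n) = ≡.cong₂ _∷_ (f≡g 0) (applyUpTo-cong (λ k → f≡g (suc k)) n)

module Polynomials {c ℓ} (R : CommutativeRing c ℓ) where
  open CommutativeRing R hiding (zero)
  open import Algebra.Properties.CommutativeSemigroup +-commutativeSemigroup
    using () renaming (interchange to +-interchange)
  open import Algebra.Properties.CommutativeSemigroup *-commutativeSemigroup
    using () renaming (x∙yz≈y∙xz to *-leftComm)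

  infixl 6 _⊕_
  infixl 7 _⊗_
  infixr 8 _·_

  _⊕_ : Poly R → Poly R → Poly R
  _⊕_ = padd R

  _·_ : Carrier → Poly R → Poly R
  _·_ = pscale R

  _⊗_ : Poly R → Poly R → Poly R
  _⊗_ = pmul R

  ∂ : Poly R → Poly R
  ∂ = deriv R

  coeff : Poly R → ℕ → Carrier
  coeff []      _       = 0#
  coeff (a ∷ p) zero    = a
  coeff (a ∷ p) (suc i) = coeff p i

  -- Coefficient lists are compared coefficientwise, so trailing zeros are irrelevant.
  infix 4 _≋_
  record _≋_ (p q : Poly R) : Set ℓ where
    constructor mk≋
    field coeff-≈ : ∀ i → coeff p i ≈ coeff q i
  open _≋_

  ≋-setoid : Setoid c ℓ
  ≋-setoid = record
    { Carrier       = Poly R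
    ; _≈_           = _≋_
    ; isEquivalence = record
      { refl  = mk≋ λ _ → refl
      ; sym   = λ p≋q → mk≋ λ i → sym (coeff-≈ p≋q i)
      ; trans = λ p≋q q≋r → mk≋ λ i → trans (coeff-≈ p≋q i) (coeff-≈ q≋r i)
      }
    }

  open Setoid ≋-setoid public using ()
    renaming (refl to ≋-refl; sym to ≋-sym; trans to ≋-trans; reflexive to ≋-reflexive)

  ≋-via : ∀ {p q} {f g : ℕ → Carrier} →
          (∀ i → coeff p i ≈ f i) → (∀ i → f i ≈ g i) → (∀ i → coeff q i ≈ g i) → p ≋ q
  ≋-via p≈f f≈g q≈g = mk≋ λ i → trans (p≈f i) (trans (f≈g i) (sym (q≈g i)))

  ∷-cong : ∀ {a b p q} → a ≈ b → p ≋ q → a ∷ p ≋ b ∷ q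
  ∷-cong a≈b p≋q = mk≋ λ { zero → a≈b ; (suc i) → coeff-≈ p≋q i }

  ∷-≋-[] : ∀ {a p} → a ≈ 0# → p ≋ [] → a ∷ p ≋ []
  ∷-≋-[] a≈0 p≋[] = mk≋ λ { zero → a≈0 ; (suc i) → coeff-≈ p≋[] i }

  ≋-tail : ∀ {a b p q} → a ∷ p ≋ b ∷ q → p ≋ q
  ≋-tail eq = mk≋ λ i → coeff-≈ eq (suc i)

  ≋-[]-tail : ∀ {a p} → a ∷ p ≋ [] → p ≋ []
  ≋-[]-tail eq = mk≋ λ i → coeff-≈ eq (suc i)

  coeff-⊕ : ∀ p q i → coeff (p ⊕ q) i ≈ coeff p i + coeff q i
  coeff-⊕ []      q       i       = sym (+-identityˡ _)
  coeff-⊕ (a ∷ p) []      i       = sym (+-identityʳ _)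
  coeff-⊕ (a ∷ p) (b ∷ q) zero    = refl
  coeff-⊕ (a ∷ p) (b ∷ q) (suc i) = coeff-⊕ p q i

  coeff-· : ∀ a p i → coeff (a · p) i ≈ a * coeff p i
  coeff-· a []      i       = sym (zeroʳ a)
  coeff-· a (b ∷ p) zero    = refl
  coeff-· a (b ∷ p) (suc i) = coeff-· a p i

  coeff-derivFrom : ∀ k p i → coeff (derivFrom R k p) i ≈ fromℕ R (k ℕ.+ i) * coeff p i
  coeff-derivFrom k []      i       = sym (zeroʳ _)
  coeff-derivFrom k (b ∷ p) zero    = reflexive (≡.cong (λ m → fromℕ R m * b) (≡.sym (ℕ.+-identityʳ k)))
  coeff-derivFrom k (b ∷ p) (suc i) = trans (coeff-derivFrom (suc k) p i)
    (reflexive (≡.cong (λ m → fromℕ R m * coeff p i) (≡.sym (ℕ.+-suc k i))))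

  coeff-∂ : ∀ p i → coeff (∂ p) i ≈ fromℕ R (suc i) * coeff p (suc i)
  coeff-∂ []      i = sym (zeroʳ _)
  coeff-∂ (a ∷ p) i = coeff-derivFrom 1 p i

  ⊕-cong : ∀ {p p' q q'} → p ≋ p' → q ≋ q' → p ⊕ q ≋ p' ⊕ q'
  ⊕-cong {p} {p'} {q} {q'} p≋p' q≋q' =
    ≋-via (coeff-⊕ p q) (λ i → +-cong (coeff-≈ p≋p' i) (coeff-≈ q≋q' i)) (coeff-⊕ p' q')

  ⊕-commutativeMonoid : CommutativeMonoid c ℓ
  ⊕-commutativeMonoid = record
    { Carrier             = Poly R
    ; _≈_                 = _≋_
    ; _∙_                 = _⊕_
    ; ε                   = []
    ; isCommutativeMonoid = record
      { isMonoid = record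
        { isSemigroup = record
          { isMagma = record { isEquivalence = Setoid.isEquivalence ≋-setoid ; ∙-cong = ⊕-cong }
          ; assoc   = λ p q r → ≋-via (λ i → trans (coeff-⊕ (p ⊕ q) r i) (+-congʳ (coeff-⊕ p q i)))
                                      (λ _ → +-assoc _ _ _)
                                      (λ i → trans (coeff-⊕ p (q ⊕ r) i) (+-congˡ (coeff-⊕ q r i)))
          }
        ; identity = (λ _ → ≋-refl) , λ p → ≋-via (coeff-⊕ p []) (λ _ → +-identityʳ _) (λ _ → refl)
        }
      ; comm = λ p q → ≋-via (coeff-⊕ p q) (λ _ → +-comm _ _) (coeff-⊕ q p)
      }
    }

  open CommutativeMonoid ⊕-commutativeMonoid using ()
    renaming (assoc to ⊕-assoc; identityʳ to ⊕-identityʳ)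
  open import Algebra.Properties.CommutativeSemigroup
    (CommutativeMonoid.commutativeSemigroup ⊕-commutativeMonoid)
    using () renaming (interchange to ⊕-interchange; x∙yz≈y∙xz to ⊕-leftComm)

  0∷-⊕ : ∀ p q → 0# ∷ (p ⊕ q) ≋ (0# ∷ p) ⊕ (0# ∷ q)
  0∷-⊕ p q = ∷-cong (sym (+-identityˡ 0#)) ≋-refl

  ·-cong : ∀ {a b p q} → a ≈ b → p ≋ q → a · p ≋ b · q
  ·-cong {a} {b} {p} {q} a≈b p≋q = ≋-via (coeff-· a p) (λ i → *-cong a≈b (coeff-≈ p≋q i)) (coeff-· b q)

  ·-distribˡ : ∀ a p q → a · (p ⊕ q) ≋ a · p ⊕ a · q
  ·-distribˡ a p q = ≋-via (λ i → trans (coeff-· a (p ⊕ q) i) (*-congˡ (coeff-⊕ p q i)))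
                           (λ _ → distribˡ a _ _)
                           (λ i → trans (coeff-⊕ (a · p) (a · q) i) (+-cong (coeff-· a p i) (coeff-· a q i)))

  ·-distribʳ : ∀ a b p → (a + b) · p ≋ a · p ⊕ b · p
  ·-distribʳ a b p = ≋-via (coeff-· (a + b) p) (λ _ → distribʳ _ a b)
                           (λ i → trans (coeff-⊕ (a · p) (b · p) i) (+-cong (coeff-· a p i) (coeff-· b p i)))

  ·-assoc : ∀ a b p → a · b · p ≋ (a * b) · p
  ·-assoc a b p = ≋-via (λ i → trans (coeff-· a (b · p) i) (*-congˡ (coeff-· b p i)))
                        (λ _ → sym (*-assoc a b _)) (coeff-· (a * b) p)

  ·-zeroˡ : ∀ p → 0# · p ≋ []
  ·-zeroˡ p = ≋-via (coeff-· 0# p) (λ _ → zeroˡ _) (λ _ → refl)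

  ·-identityˡ : ∀ p → 1# · p ≋ p
  ·-identityˡ p = ≋-via (coeff-· 1# p) (λ _ → *-identityˡ _) (λ _ → refl)

  ·-0∷ : ∀ a p → a · (0# ∷ p) ≋ 0# ∷ a · p
  ·-0∷ a p = ∷-cong (zeroʳ a) ≋-refl

  eval-⊕ : ∀ p q x → eval R (p ⊕ q) x ≈ eval R p x + eval R q x
  eval-⊕ []      q       x = sym (+-identityˡ _)
  eval-⊕ (a ∷ p) []      x = sym (+-identityʳ _)
  eval-⊕ (a ∷ p) (b ∷ q) x = begin
    (a + b) + x * eval R (p ⊕ q) x                ≈⟨ +-congˡ (*-congˡ (eval-⊕ p q x)) ⟩
    (a + b) + x * (eval R p x + eval R q x)       ≈⟨ +-congˡ (distribˡ x _ _) ⟩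
    (a + b) + (x * eval R p x + x * eval R q x)   ≈⟨ +-interchange a b _ _ ⟩
    (a + x * eval R p x) + (b + x * eval R q x)   ∎
    where open SetoidReasoning setoid

  eval-· : ∀ a p x → eval R (a · p) x ≈ a * eval R p x
  eval-· a []      x = sym (zeroʳ a)
  eval-· a (b ∷ p) x = begin
    a * b + x * eval R (a · p) x   ≈⟨ +-congˡ (*-congˡ (eval-· a p x)) ⟩
    a * b + x * (a * eval R p x)   ≈⟨ +-congˡ (*-leftComm x a _) ⟩
    a * b + a * (x * eval R p x)   ≈⟨ distribˡ a b _ ⟨
    a * (b + x * eval R p x)       ∎
    where open SetoidReasoning setoid

  eval-≋-[] : ∀ {p} x → p ≋ [] → eval R p x ≈ 0#
  eval-≋-[] {[]}    x _    = refl
  eval-≋-[] {a ∷ p} x p≋[] =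
    trans (+-cong (coeff-≈ p≋[] 0) (trans (*-congˡ (eval-≋-[] x (≋-[]-tail p≋[]))) (zeroʳ x)))
          (+-identityˡ 0#)

  eval-cong : ∀ {p q} x → p ≋ q → eval R p x ≈ eval R q x
  eval-cong {[]}    {q}     x p≋q = sym (eval-≋-[] x (≋-sym p≋q))
  eval-cong {a ∷ p} {[]}    x p≋q = eval-≋-[] x p≋q
  eval-cong {a ∷ p} {b ∷ q} x p≋q = +-cong (coeff-≈ p≋q 0) (*-congˡ (eval-cong x (≋-tail p≋q)))

  ⊗-congʳ : ∀ p {q q'} → q ≋ q' → p ⊗ q ≋ p ⊗ q'
  ⊗-congʳ []      q≋q' = ≋-refl
  ⊗-congʳ (a ∷ p) q≋q' = ⊕-cong (·-cong refl q≋q') (∷-cong refl (⊗-congʳ p q≋q'))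

  ⊗-zeroˡ : ∀ {p} q → p ≋ [] → p ⊗ q ≋ []
  ⊗-zeroˡ {[]}    q _    = ≋-refl
  ⊗-zeroˡ {a ∷ p} q p≋[] = ⊕-cong (≋-trans (·-cong (coeff-≈ p≋[] 0) ≋-refl) (·-zeroˡ q))
                                   (∷-≋-[] refl (⊗-zeroˡ q (≋-[]-tail p≋[])))

  ⊗-congˡ : ∀ {p p'} q → p ≋ p' → p ⊗ q ≋ p' ⊗ q
  ⊗-congˡ {[]}    {p'}     q p≋p' = ≋-sym (⊗-zeroˡ q (≋-sym p≋p'))
  ⊗-congˡ {a ∷ p} {[]}     q p≋p' = ⊗-zeroˡ q p≋p'
  ⊗-congˡ {a ∷ p} {b ∷ p'} q p≋p' =
    ⊕-cong (·-cong (coeff-≈ p≋p' 0) ≋-refl) (∷-cong refl (⊗-congˡ q (≋-tail p≋p')))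

  ⊗-zeroʳ : ∀ p → p ⊗ [] ≋ []
  ⊗-zeroʳ []      = ≋-refl
  ⊗-zeroʳ (a ∷ p) = ∷-≋-[] refl (⊗-zeroʳ p)

  ⊗-identityˡ : ∀ q → pone R ⊗ q ≋ q
  ⊗-identityˡ q = ≋-trans (⊕-cong (·-identityˡ q) (∷-≋-[] refl ≋-refl)) (⊕-identityʳ q)

  0∷-⊗ : ∀ p q → (0# ∷ p) ⊗ q ≋ 0# ∷ p ⊗ q
  0∷-⊗ p q = ⊕-cong (·-zeroˡ q) ≋-refl

  ⊗-distribʳ : ∀ p q r → (p ⊕ q) ⊗ r ≋ p ⊗ r ⊕ q ⊗ r
  ⊗-distribʳ []      q       r = ≋-refl
  ⊗-distribʳ (a ∷ p) []      r = ≋-sym (⊕-identityʳ _)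
  ⊗-distribʳ (a ∷ p) (b ∷ q) r = ≋-trans
    (⊕-cong (·-distribʳ a b r) (≋-trans (∷-cong refl (⊗-distribʳ p q r)) (0∷-⊕ (p ⊗ r) (q ⊗ r))))
    (⊕-interchange (a · r) (b · r) (0# ∷ p ⊗ r) (0# ∷ q ⊗ r))

  ⊗-distribˡ : ∀ p q r → p ⊗ (q ⊕ r) ≋ p ⊗ q ⊕ p ⊗ r
  ⊗-distribˡ []      q r = ≋-refl
  ⊗-distribˡ (a ∷ p) q r = ≋-trans
    (⊕-cong (·-distribˡ a q r) (≋-trans (∷-cong refl (⊗-distribˡ p q r)) (0∷-⊕ (p ⊗ q) (p ⊗ r))))
    (⊕-interchange (a · q) (a · r) (0# ∷ p ⊗ q) (0# ∷ p ⊗ r))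

  ·-⊗ : ∀ a p q → a · p ⊗ q ≋ a · (p ⊗ q)
  ·-⊗ a []      q = ≋-refl
  ·-⊗ a (b ∷ p) q = ≋-trans
    (⊕-cong (≋-sym (·-assoc a b q)) (≋-trans (∷-cong refl (·-⊗ a p q)) (≋-sym (·-0∷ a _))))
    (≋-sym (·-distribˡ a (b · q) (0# ∷ p ⊗ q)))

  ⊗-· : ∀ a p q → p ⊗ a · q ≋ a · (p ⊗ q)
  ⊗-· a []      q = ≋-refl
  ⊗-· a (b ∷ p) q = ≋-trans
    (⊕-cong (≋-trans (·-assoc b a q) (≋-trans (·-cong (*-comm b a) ≋-refl) (≋-sym (·-assoc a b q))))
            (≋-trans (∷-cong refl (⊗-· a p q)) (≋-sym (·-0∷ a _))))
    (≋-sym (·-distribˡ a (b · q) (0# ∷ p ⊗ q)))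

  ⊗-assoc : ∀ p q r → p ⊗ q ⊗ r ≋ p ⊗ (q ⊗ r)
  ⊗-assoc []      q r = ≋-refl
  ⊗-assoc (a ∷ p) q r = ≋-trans (⊗-distribʳ (a · q) (0# ∷ p ⊗ q) r)
    (⊕-cong (·-⊗ a q r) (≋-trans (0∷-⊗ (p ⊗ q) r) (∷-cong refl (⊗-assoc p q r))))

  ⊗-∷ : ∀ p b q → p ⊗ (b ∷ q) ≋ b · p ⊕ (0# ∷ p ⊗ q)
  ⊗-∷ []      b q = ≋-sym (∷-≋-[] refl ≋-refl)
  ⊗-∷ (a ∷ p) b q = ∷-cong (+-congʳ (*-comm a b))
    (≋-trans (⊕-cong (≋-refl {a · q}) (⊗-∷ p b q)) (⊕-leftComm (a · q) (b · p) (0# ∷ p ⊗ q)))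

  ⊗-comm : ∀ p q → p ⊗ q ≋ q ⊗ p
  ⊗-comm []      q = ≋-sym (⊗-zeroʳ q)
  ⊗-comm (a ∷ p) q = ≋-trans (⊕-cong (≋-refl {a · q}) (∷-cong refl (⊗-comm p q))) (≋-sym (⊗-∷ q a p))

  ⊗-leftComm : ∀ p q r → p ⊗ (q ⊗ r) ≋ q ⊗ (p ⊗ r)
  ⊗-leftComm p q r = ≋-trans (≋-sym (⊗-assoc p q r))
    (≋-trans (⊗-congˡ r (⊗-comm p q)) (⊗-assoc q p r))

  eval-⊗ : ∀ p q x → eval R (p ⊗ q) x ≈ eval R p x * eval R q x
  eval-⊗ []      q x = sym (zeroˡ _)
  eval-⊗ (a ∷ p) q x = begin
    eval R (a · q ⊕ (0# ∷ p ⊗ q)) x                    ≈⟨ eval-⊕ (a · q) _ x ⟩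
    eval R (a · q) x + (0# + x * eval R (p ⊗ q) x)     ≈⟨ +-cong (eval-· a q x) (+-identityˡ _) ⟩
    a * eval R q x + x * eval R (p ⊗ q) x              ≈⟨ +-congˡ (*-congˡ (eval-⊗ p q x)) ⟩
    a * eval R q x + x * (eval R p x * eval R q x)     ≈⟨ +-congˡ (*-assoc x _ _) ⟨
    a * eval R q x + x * eval R p x * eval R q x       ≈⟨ distribʳ _ a _ ⟨
    (a + x * eval R p x) * eval R q x                  ∎
    where open SetoidReasoning setoid

  eval-linear-root : ∀ a → eval R (linear R a) a ≈ 0#
  eval-linear-root a = begin
    - a + a * (1# + a * 0#)  ≈⟨ +-congˡ (*-congˡ (trans (+-congˡ (zeroʳ a)) (+-identityʳ 1#))) ⟩
    - a + a * 1#             ≈⟨ +-congˡ (*-identityʳ a) ⟩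
    - a + a                  ≈⟨ -‿inverseˡ a ⟩
    0#                       ∎
    where open SetoidReasoning setoid

  eval-ppow-linear-root : ∀ a {k} → 1 ≤ k → eval R (ppow R (linear R a) k) a ≈ 0#
  eval-ppow-linear-root a {suc k} _ =
    trans (eval-⊗ (linear R a) (ppow R (linear R a) k) a) (trans (*-congʳ (eval-linear-root a)) (zeroˡ _))

  linear-shift : ∀ a b → linear R b ≋ linear R a ⊕ (a - b) · pone R
  linear-shift a b = ∷-cong (sym (begin
    - a + (a - b) * 1#   ≈⟨ +-congˡ (*-identityʳ _) ⟩
    - a + (a - b)        ≈⟨ +-assoc (- a) a (- b) ⟨
    (- a + a) - b        ≈⟨ +-congʳ (-‿inverseˡ a) ⟩
    0# - b               ≈⟨ +-identityˡ (- b) ⟩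
    - b                  ∎)) ≋-refl
    where open SetoidReasoning setoid

  ∂-cong : ∀ {p q} → p ≋ q → ∂ p ≋ ∂ q
  ∂-cong {p} {q} p≋q = ≋-via (coeff-∂ p) (λ i → *-congˡ (coeff-≈ p≋q (suc i))) (coeff-∂ q)

  ∂-⊕ : ∀ p q → ∂ (p ⊕ q) ≋ ∂ p ⊕ ∂ q
  ∂-⊕ p q = ≋-via (λ i → trans (coeff-∂ (p ⊕ q) i) (*-congˡ (coeff-⊕ p q (suc i))))
                  (λ _ → distribˡ _ _ _)
                  (λ i → trans (coeff-⊕ (∂ p) (∂ q) i) (+-cong (coeff-∂ p i) (coeff-∂ q i)))

  ∂-· : ∀ a p → ∂ (a · p) ≋ a · ∂ p
  ∂-· a p = ≋-via (λ i → trans (coeff-∂ (a · p) i) (*-congˡ (coeff-· a p (suc i))))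
                  (λ _ → *-leftComm _ a _)
                  (λ i → trans (coeff-· a (∂ p) i) (*-congˡ (coeff-∂ p i)))

  -- a ∷ p stands for a + z p, so this is the product rule (z p)′ = p + z p′.
  ∂-∷ : ∀ a p → ∂ (a ∷ p) ≋ p ⊕ (0# ∷ ∂ p)
  ∂-∷ a p = mk≋ λ i → trans (coeff-derivFrom 1 p i) (trans (shift i) (sym (coeff-⊕ p (0# ∷ ∂ p) i)))
    where
    shift : ∀ i → (1# + fromℕ R i) * coeff p i ≈ coeff p i + coeff (0# ∷ ∂ p) i
    shift zero    = trans (distribʳ _ 1# 0#) (+-cong (*-identityˡ _) (zeroˡ _))
    shift (suc i) = trans (distribʳ _ 1# _) (+-cong (*-identityˡ _) (sym (coeff-∂ p i)))

  ∂-⊗ : ∀ p q → ∂ (p ⊗ q) ≋ ∂ p ⊗ q ⊕ p ⊗ ∂ q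
  ∂-⊗ []      q = ≋-refl
  ∂-⊗ (a ∷ p) q = begin
    ∂ (a · q ⊕ (0# ∷ p ⊗ q))                            ≈⟨ ∂-⊕ (a · q) _ ⟩
    ∂ (a · q) ⊕ ∂ (0# ∷ p ⊗ q)                          ≈⟨ ⊕-cong (∂-· a q) (∂-∷ 0# (p ⊗ q)) ⟩
    a · ∂ q ⊕ (p ⊗ q ⊕ (0# ∷ ∂ (p ⊗ q)))                ≈⟨ ⊕-cong (≋-refl {a · ∂ q})
                                                            (⊕-cong (≋-refl {p ⊗ q})
                                                              (≋-trans (∷-cong refl (∂-⊗ p q)) (0∷-⊕ (∂ p ⊗ q) (p ⊗ ∂ q)))) ⟩
    a · ∂ q ⊕ (p ⊗ q ⊕ ((0# ∷ ∂ p ⊗ q) ⊕ (0# ∷ p ⊗ ∂ q)))  ≈⟨ ⊕-leftComm (a · ∂ q) (p ⊗ q) _ ⟩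
    p ⊗ q ⊕ (a · ∂ q ⊕ ((0# ∷ ∂ p ⊗ q) ⊕ (0# ∷ p ⊗ ∂ q)))  ≈⟨ ⊕-cong (≋-refl {p ⊗ q})
                                                              (⊕-leftComm (a · ∂ q) (0# ∷ ∂ p ⊗ q) _) ⟩
    p ⊗ q ⊕ ((0# ∷ ∂ p ⊗ q) ⊕ (a · ∂ q ⊕ (0# ∷ p ⊗ ∂ q)))  ≈⟨ ⊕-assoc (p ⊗ q) _ _ ⟨
    (p ⊗ q ⊕ (0# ∷ ∂ p ⊗ q)) ⊕ (a · ∂ q ⊕ (0# ∷ p ⊗ ∂ q))  ≈⟨ ⊕-cong (≋-trans (⊗-distribʳ p (0# ∷ ∂ p) q)
                                                              (⊕-cong (≋-refl {p ⊗ q}) (0∷-⊗ (∂ p) q)))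
                                                            (≋-refl {(a ∷ p) ⊗ ∂ q}) ⟨
    (p ⊕ (0# ∷ ∂ p)) ⊗ q ⊕ (a ∷ p) ⊗ ∂ q                  ≈⟨ ⊕-cong (⊗-congˡ q (∂-∷ a p)) (≋-refl {(a ∷ p) ⊗ ∂ q}) ⟨
    ∂ (a ∷ p) ⊗ q ⊕ (a ∷ p) ⊗ ∂ q                          ∎
    where open SetoidReasoning ≋-setoid

  ∂-linear : ∀ a → ∂ (linear R a) ≋ pone R
  ∂-linear a = ∷-cong (trans (*-identityʳ _) (+-identityʳ 1#)) ≋-refl

  ∂-ppow-linear : ∀ a k → ∂ (ppow R (linear R a) k) ≋ fromℕ R k · ppow R (linear R a) (k ∸ 1)
  ∂-ppow-linear a zero    = ≋-sym (·-zeroˡ _)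
  ∂-ppow-linear a (suc k) = begin
    ∂ (linear R a ⊗ X)                             ≈⟨ ∂-⊗ (linear R a) X ⟩
    ∂ (linear R a) ⊗ X ⊕ linear R a ⊗ ∂ X          ≈⟨ ⊕-cong (≋-trans (⊗-congˡ X (∂-linear a)) (⊗-identityˡ X))
                                                             (⊗-congʳ (linear R a) (∂-ppow-linear a k)) ⟩
    X ⊕ linear R a ⊗ fromℕ R k · Y                 ≈⟨ ⊕-cong (≋-refl {X}) (⊗-· (fromℕ R k) (linear R a) Y) ⟩
    X ⊕ fromℕ R k · (linear R a ⊗ Y)               ≈⟨ collect k ⟩
    fromℕ R (suc k) · X                            ∎
    where
    open SetoidReasoning ≋-setoid
    X = ppow R (linear R a) k
    Y = ppow R (linear R a) (k ∸ 1)
    collect : ∀ k → ppow R (linear R a) k ⊕ fromℕ R k · (linear R a ⊗ ppow R (linear R a) (k ∸ 1))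
                    ≋ fromℕ R (suc k) · ppow R (linear R a) k
    collect zero    = ≋-trans (⊕-cong (≋-refl {pone R}) (·-zeroˡ (linear R a ⊗ pone R)))
                        (≋-trans (⊕-identityʳ (pone R))
                          (≋-sym (≋-trans (·-cong (+-identityʳ 1#) (≋-refl {pone R})) (·-identityˡ (pone R)))))
    collect (suc k) = ≋-sym (≋-trans (·-distribʳ 1# (fromℕ R (suc k)) Z)
                                     (⊕-cong (·-identityˡ Z) (≋-refl {fromℕ R (suc k) · Z})))
      where Z = ppow R (linear R a) (suc k)

  record DegreeAtMost (T : ℕ) (p : Poly R) : Set ℓ where
    constructor mkDeg
    field vanishes : ∀ i → T < i → coeff p i ≈ 0#
  open DegreeAtMost

  degree-cong : ∀ {T p q} → p ≋ q → DegreeAtMost T p → DegreeAtMost T q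
  degree-cong p≋q d = mkDeg λ i lt → trans (sym (coeff-≈ p≋q i)) (vanishes d i lt)

  degree-mono : ∀ {T T' p} → T ≤ T' → DegreeAtMost T p → DegreeAtMost T' p
  degree-mono T≤T' d = mkDeg λ i lt → vanishes d i (ℕ.≤-<-trans T≤T' lt)

  degree-[] : ∀ {T} → DegreeAtMost T []
  degree-[] = mkDeg λ _ _ → refl

  degree-const : ∀ {a} → DegreeAtMost 0 (a ∷ [])
  degree-const = mkDeg λ { (suc i) _ → refl }

  degree-∷ : ∀ {T a p} → DegreeAtMost T p → DegreeAtMost (suc T) (a ∷ p)
  degree-∷ d = mkDeg λ { (suc i) (s≤s lt) → vanishes d i lt }

  degree-tail : ∀ {T a p} → DegreeAtMost (suc T) (a ∷ p) → DegreeAtMost T p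
  degree-tail d = mkDeg λ i lt → vanishes d (suc i) (s≤s lt)

  degree-0-tail : ∀ {a p} → DegreeAtMost 0 (a ∷ p) → p ≋ []
  degree-0-tail d = mk≋ λ i → vanishes d (suc i) (s≤s z≤n)

  degree-⊕ : ∀ {T p q} → DegreeAtMost T p → DegreeAtMost T q → DegreeAtMost T (p ⊕ q)
  degree-⊕ {p = p} {q} dp dq = mkDeg λ i lt →
    trans (coeff-⊕ p q i) (trans (+-cong (vanishes dp i lt) (vanishes dq i lt)) (+-identityˡ 0#))

  degree-· : ∀ {T a p} → DegreeAtMost T p → DegreeAtMost T (a · p)
  degree-· {a = a} {p} dp = mkDeg λ i lt → trans (coeff-· a p i) (trans (*-congˡ (vanishes dp i lt)) (zeroʳ a))

  degree-⊗ : ∀ {m n} p {q} → DegreeAtMost m p → DegreeAtMost n q → DegreeAtMost (m ℕ.+ n) (p ⊗ q)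
  degree-⊗ []              _  _  = degree-[]
  degree-⊗ {m} {n} (a ∷ p) {q} dp dq = degree-⊕ (degree-mono (ℕ.m≤n+m n m) (degree-· dq)) (shifted m dp)
    where
    shifted : ∀ m → DegreeAtMost m (a ∷ p) → DegreeAtMost (m ℕ.+ n) (0# ∷ p ⊗ q)
    shifted zero    d = degree-cong (≋-sym (∷-≋-[] refl (⊗-zeroˡ q (degree-0-tail d)))) degree-[]
    shifted (suc m) d = degree-∷ (degree-⊗ p (degree-tail d) dq)

  degree-ppow-linear : ∀ a k → DegreeAtMost k (ppow R (linear R a) k)
  degree-ppow-linear a zero    = degree-const
  degree-ppow-linear a (suc k) = degree-⊗ (linear R a) (degree-∷ degree-const) (degree-ppow-linear a k)

  degree-∂ : ∀ {T p} → DegreeAtMost (suc T) p → DegreeAtMost T (∂ p)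
  degree-∂ {p = p} d = mkDeg λ i lt → trans (coeff-∂ p i) (trans (*-congˡ (vanishes d (suc i) (s≤s lt))) (zeroʳ _))

  ∂-degree-0 : ∀ {p} → DegreeAtMost 0 p → ∂ p ≋ []
  ∂-degree-0 {p} d = mk≋ λ i → trans (coeff-∂ p i) (trans (*-congˡ (vanishes d (suc i) (s≤s z≤n))) (zeroʳ _))

  evalDerivSum : ℕ → Poly R → Carrier → Carrier
  evalDerivSum zero    p x = eval R p x
  evalDerivSum (suc T) p x = eval R p x + evalDerivSum T (∂ p) x

  evalDerivSum-cong : ∀ T {p q} x → p ≋ q → evalDerivSum T p x ≈ evalDerivSum T q x
  evalDerivSum-cong zero    x p≋q = eval-cong x p≋q
  evalDerivSum-cong (suc T) x p≋q = +-cong (eval-cong x p≋q) (evalDerivSum-cong T x (∂-cong p≋q))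

  evalDerivSum-[] : ∀ T x → evalDerivSum T [] x ≈ 0#
  evalDerivSum-[] zero    x = refl
  evalDerivSum-[] (suc T) x = trans (+-congˡ (evalDerivSum-[] T x)) (+-identityʳ 0#)

  evalDerivSum-⊕ : ∀ T p q x → evalDerivSum T (p ⊕ q) x ≈ evalDerivSum T p x + evalDerivSum T q x
  evalDerivSum-⊕ zero    p q x = eval-⊕ p q x
  evalDerivSum-⊕ (suc T) p q x = trans
    (+-cong (eval-⊕ p q x)
            (trans (evalDerivSum-cong T x (∂-⊕ p q)) (evalDerivSum-⊕ T (∂ p) (∂ q) x)))
    (+-interchange _ _ _ _)

  evalDerivSum-· : ∀ T a p x → evalDerivSum T (a · p) x ≈ a * evalDerivSum T p x
  evalDerivSum-· zero    a p x = eval-· a p x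
  evalDerivSum-· (suc T) a p x = trans
    (+-cong (eval-· a p x) (trans (evalDerivSum-cong T x (∂-· a p)) (evalDerivSum-· T a (∂ p) x)))
    (sym (distribˡ a _ _))

  evalDerivSum-mono : ∀ {T T'} {p} x → T ≤ T' → DegreeAtMost T p → evalDerivSum T' p x ≈ evalDerivSum T p x
  evalDerivSum-mono {T' = zero}   x z≤n d = refl
  evalDerivSum-mono {zero} {suc T'} x z≤n d = trans (+-congˡ (trans (evalDerivSum-cong T' x (∂-degree-0 d))
                                                                   (evalDerivSum-[] T' x)))
                                                     (+-identityʳ _)
  evalDerivSum-mono {suc T} {suc T'} x (s≤s T≤T') d = +-congˡ (evalDerivSum-mono x T≤T' (degree-∂ d))

  evalDerivSum-unfold : ∀ T {p} x → DegreeAtMost T p → evalDerivSum T p x ≈ eval R p x + evalDerivSum T (∂ p) x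
  evalDerivSum-unfold T x d = sym (evalDerivSum-mono x (ℕ.n≤1+n T) d)

  evalDerivSum-indep : ∀ {T T'} {p} x → DegreeAtMost T p → DegreeAtMost T' p →
                       evalDerivSum T p x ≈ evalDerivSum T' p x
  evalDerivSum-indep {T} {T'} x d d' with ℕ.≤-total T T'
  ... | inj₁ T≤T' = sym (evalDerivSum-mono x T≤T' d)
  ... | inj₂ T'≤T = evalDerivSum-mono x T'≤T d'

  derivN-suc : ∀ k p → derivN R (suc k) p ≡ derivN R k (∂ p)
  derivN-suc zero    p = ≡.refl
  derivN-suc (suc k) p = ≡.cong ∂ (derivN-suc k p)

  eval-sumOfDerivs : ∀ T p x →
    eval R (foldr _⊕_ [] (map (λ k → derivN R k p) (upTo (suc T)))) x ≈ evalDerivSum T p x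
  eval-sumOfDerivs T p x =
    trans (reflexive (≡.cong (λ ps → eval R (foldr _⊕_ [] ps) x) (List.map-applyUpTo (λ k → k) (λ k → derivN R k p) (suc T))))
          (go T p)
    where
    go : ∀ T p → eval R (foldr _⊕_ [] (applyUpTo (λ k → derivN R k p) (suc T))) x ≈ evalDerivSum T p x
    go zero    p = trans (eval-⊕ p [] x) (+-identityʳ _)
    go (suc T) p = trans (eval-⊕ p _ x) (+-congˡ (trans
      (reflexive (≡.cong (λ ps → eval R (foldr _⊕_ [] ps) x) (applyUpTo-cong (λ k → derivN-suc k p) (suc T))))
      (go T (∂ p))))

  sumOver : ∀ {A : Set} → List A → (A → Carrier) → Carrier
  sumOver xs g = foldr (λ i acc → g i + acc) 0# xs

  sumOver-cong : ∀ {A : Set} (xs : List A) {g h : A → Carrier} → (∀ i → g i ≈ h i) → sumOver xs g ≈ sumOver xs h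
  sumOver-cong []       g≈h = refl
  sumOver-cong (x ∷ xs) g≈h = +-cong (g≈h x) (sumOver-cong xs g≈h)

  sumOver-+ : ∀ {A : Set} (xs : List A) (g h : A → Carrier) →
              sumOver xs (λ i → g i + h i) ≈ sumOver xs g + sumOver xs h
  sumOver-+ []       g h = sym (+-identityˡ 0#)
  sumOver-+ (x ∷ xs) g h = trans (+-congˡ (sumOver-+ xs g h)) (+-interchange _ _ _ _)

  sumOver-vanishing : ∀ {A : Set} {xs : List A} {k} {g : A → Carrier} →
                      All (_≢ k) xs → (∀ i → i ≢ k → g i ≈ 0#) → sumOver xs g ≈ 0#
  sumOver-vanishing []           g≈0 = refl
  sumOver-vanishing (x≢k ∷ ≢ks) g≈0 = trans (+-cong (g≈0 _ x≢k) (sumOver-vanishing ≢ks g≈0)) (+-identityʳ 0#)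

  sumOver-indicator : ∀ {A : Set} {xs : List A} {k} {g : A → Carrier} →
                      Unique xs → k ∈ xs → (∀ i → i ≢ k → g i ≈ 0#) → sumOver xs g ≈ g k
  sumOver-indicator (x∉ ∷ _) (here ≡.refl) g≈0 =
    trans (+-congˡ (sumOver-vanishing (All.map ≡.≢-sym x∉) g≈0)) (+-identityʳ _)
  sumOver-indicator (x∉ ∷ u) (there k∈xs) g≈0 =
    trans (+-cong (g≈0 _ (All.lookup x∉ k∈xs)) (sumOver-indicator u k∈xs g≈0)) (+-identityˡ _)

  psumOver : ∀ {A : Set} → List A → (A → Poly R) → Poly R
  psumOver xs G = foldr (λ i acc → G i ⊕ acc) [] xs

  psumOver-cong : ∀ {A : Set} {xs : List A} {G H : A → Poly R} →
                  All (λ i → G i ≋ H i) xs → psumOver xs G ≋ psumOver xs H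
  psumOver-cong []           = ≋-refl
  psumOver-cong (G≋H ∷ G≋Hs) = ⊕-cong G≋H (psumOver-cong G≋Hs)

  ⊗-psumOver : ∀ {A : Set} p (xs : List A) G → p ⊗ psumOver xs G ≋ psumOver xs (λ i → p ⊗ G i)
  ⊗-psumOver p []       G = ⊗-zeroʳ p
  ⊗-psumOver p (x ∷ xs) G = ≋-trans (⊗-distribˡ p (G x) _) (⊕-cong ≋-refl (⊗-psumOver p xs G))

  evalDerivSum-psumOver : ∀ {A : Set} T (xs : List A) G x →
                          evalDerivSum T (psumOver xs G) x ≈ sumOver xs (λ i → evalDerivSum T (G i) x)
  evalDerivSum-psumOver T []       G x = evalDerivSum-[] T x
  evalDerivSum-psumOver T (y ∷ xs) G x =
    trans (evalDerivSum-⊕ T (G y) _ x) (+-congˡ (evalDerivSum-psumOver T xs G x))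

module NodeProducts {c ℓ} (R : CommutativeRing c ℓ) {s : ℕ} (α : Fin s → CommutativeRing.Carrier R) where
  open CommutativeRing R hiding (zero)
  open Polynomials R

  fList : (Fin s → ℕ) → List (Fin s) → Poly R
  fList n xs = foldr (λ i acc → ppow R (linear R (α i)) (n i) ⊗ acc) (pone R) xs

  totalOver : (Fin s → ℕ) → List (Fin s) → ℕ
  totalOver n xs = foldr (λ i acc → n i ℕ.+ acc) 0 xs

  plusE-≡ : ∀ n l → plusE R α n l l ≡ suc (n l)
  plusE-≡ n l with l ≟ l
  ... | yes _   = ≡.refl
  ... | no l≢l = contradiction ≡.refl l≢l

  plusE-≢ : ∀ n l {i} → i ≢ l → plusE R α n l i ≡ n i
  plusE-≢ n l {i} i≢l with i ≟ l
  ... | yes i≡l = contradiction i≡l i≢l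
  ... | no _    = ≡.refl

  minusE-≡ : ∀ n l → minusE R α n l l ≡ n l ∸ 1
  minusE-≡ n l with l ≟ l
  ... | yes _   = ≡.refl
  ... | no l≢l = contradiction ≡.refl l≢l

  minusE-≢ : ∀ n l {i} → i ≢ l → minusE R α n l i ≡ n i
  minusE-≢ n l {i} i≢l with i ≟ l
  ... | yes i≡l = contradiction i≡l i≢l
  ... | no _    = ≡.refl

  minusE-cong : ∀ {n n'} l i → n i ≡ n' i → minusE R α n l i ≡ minusE R α n' l i
  minusE-cong l i eq with i ≟ l
  ... | yes _ = ≡.cong (_∸ 1) eq
  ... | no _  = eq

  minusE-≤ : ∀ n l i → minusE R α n l i ≤ n i
  minusE-≤ n l i with i ≟ l
  ... | yes _ = ℕ.m∸n≤m (n i) 1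
  ... | no _  = ℕ.≤-refl

  δ-≡ : ∀ k → δ R α k k ≈ 1#
  δ-≡ k with k ≟ k
  ... | yes _   = refl
  ... | no k≢k = contradiction ≡.refl k≢k

  δ-≢ : ∀ {k j} → k ≢ j → δ R α k j ≈ 0#
  δ-≢ {k} {j} k≢j with k ≟ j
  ... | yes k≡j = contradiction k≡j k≢j
  ... | no _    = refl

  fList-cong : ∀ {n n'} xs → All (λ i → n i ≡ n' i) xs → fList n xs ≡ fList n' xs
  fList-cong []       []         = ≡.refl
  fList-cong (x ∷ xs) (eq ∷ eqs) =
    ≡.cong₂ (λ k p → ppow R (linear R (α x)) k ⊗ p) eq (fList-cong xs eqs)

  degree-fList : ∀ {n m} xs → (∀ i → n i ≤ m i) → DegreeAtMost (totalOver m xs) (fList n xs)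
  degree-fList []       n≤m = degree-const
  degree-fList (x ∷ xs) n≤m =
    degree-⊗ _ (degree-mono (n≤m x) (degree-ppow-linear (α x) _)) (degree-fList xs n≤m)

  fList-root : ∀ n {xs j} → j ∈ xs → 1 ≤ n j → eval R (fList n xs) (α j) ≈ 0#
  fList-root n {x ∷ xs} (here ≡.refl) 1≤nj =
    trans (eval-⊗ (ppow R (linear R (α x)) (n x)) (fList n xs) (α x)) (trans (*-congʳ (eval-ppow-linear-root (α x) 1≤nj)) (zeroˡ _))
  fList-root n {x ∷ xs} (there j∈xs) 1≤nj =
    trans (eval-⊗ (ppow R (linear R (α x)) (n x)) (fList n xs) _) (trans (*-congˡ (fList-root n j∈xs 1≤nj)) (zeroʳ _))

  fList-raise : ∀ {m m' xs i} → Unique xs → i ∈ xs →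
                m' i ≡ suc (m i) → (∀ z → z ≢ i → m' z ≡ m z) →
                fList m' xs ≋ linear R (α i) ⊗ fList m xs
  fList-raise {m} {m'} {x ∷ xs} (x∉ ∷ _) (here ≡.refl) m'x≡ m'≡m = ≋-trans
    (≋-reflexive (≡.cong₂ (λ k p → ppow R (linear R (α x)) k ⊗ p)
                          m'x≡ (fList-cong xs (All.map (λ x≢z → m'≡m _ (≡.≢-sym x≢z)) x∉))))
    (⊗-assoc (linear R (α x)) (ppow R (linear R (α x)) (m x)) (fList m xs))
  fList-raise {m} {m'} {x ∷ xs} {i} (x∉ ∷ u) (there i∈xs) m'i≡ m'≡m = ≋-trans
    (≋-reflexive (≡.cong (λ k → ppow R (linear R (α x)) k ⊗ fList m' xs) (m'≡m x (All.lookup x∉ i∈xs))))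
    (≋-trans (⊗-congʳ (ppow R (linear R (α x)) (m x)) (fList-raise u i∈xs m'i≡ m'≡m))
             (⊗-leftComm (ppow R (linear R (α x)) (m x)) (linear R (α i)) (fList m xs)))

  ∂-fList : ∀ n {xs} → Unique xs →
            ∂ (fList n xs) ≋ psumOver xs (λ m → fromℕ R (n m) · fList (minusE R α n m) xs)
  ∂-fList n {[]}     []        = ≋-refl
  ∂-fList n {x ∷ xs} (x∉ ∷ u) = ≋-trans (∂-⊗ P (fList n xs)) (⊕-cong own others)
    where
    P : Poly R
    P = ppow R (linear R (α x)) (n x)

    own : ∂ P ⊗ fList n xs ≋ fromℕ R (n x) · fList (minusE R α n x) (x ∷ xs)
    own = ≋-trans (⊗-congˡ (fList n xs) (∂-ppow-linear (α x) (n x)))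
      (≋-trans (·-⊗ (fromℕ R (n x)) (ppow R (linear R (α x)) (n x ∸ 1)) (fList n xs))
        (·-cong refl (≋-reflexive (≡.cong₂ (λ k p → ppow R (linear R (α x)) k ⊗ p)
          (≡.sym (minusE-≡ n x))
          (fList-cong xs (All.map (λ x≢z → ≡.sym (minusE-≢ n x (≡.≢-sym x≢z))) x∉))))))

    others : P ⊗ ∂ (fList n xs) ≋ psumOver xs (λ m → fromℕ R (n m) · fList (minusE R α n m) (x ∷ xs))
    others = ≋-trans (⊗-congʳ P (∂-fList n u)) (≋-trans (⊗-psumOver P xs _) (psumOver-cong (All.map
      (λ {m} x≢m → ≋-trans (⊗-· (fromℕ R (n m)) P _)
        (·-cong refl (≋-reflexive (≡.cong (λ k → ppow R (linear R (α x)) k ⊗ fList (minusE R α n m) xs)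
          (≡.sym (minusE-≢ n m x≢m))))))
      x∉)))

  avec-evalDerivSum : ∀ {T} n j → DegreeAtMost T (fpoly R α n) →
                      avec R α n j ≈ evalDerivSum T (fpoly R α n) (α j)
  avec-evalDerivSum n j d = trans (eval-sumOfDerivs (total R α n) (fpoly R α n) (α j))
    (evalDerivSum-indep (α j) (degree-fList (allFin s) (λ _ → ℕ.≤-refl)) d)

  degree-fpoly-minusE : ∀ n m → DegreeAtMost (total R α n) (fpoly R α (minusE R α n m))
  degree-fpoly-minusE n m = degree-fList (allFin s) (minusE-≤ n m)

  avec-recurrence : ∀ n j → 1 ≤ n j →
    avec R α n j ≈ sumOver (allFin s) (λ m → fromℕ R (n m) * avec R α (minusE R α n m) j)
  avec-recurrence n j 1≤nj = begin
    avec R α n j                                           ≈⟨ avec-evalDerivSum n j df ⟩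
    evalDerivSum T f x                                     ≈⟨ evalDerivSum-unfold T x df ⟩
    eval R f x + evalDerivSum T (∂ f) x                    ≈⟨ +-cong (fList-root n (∈-allFin j) 1≤nj)
                                                                (evalDerivSum-cong T x (∂-fList n (allFin⁺ s))) ⟩
    0# + evalDerivSum T (psumOver (allFin s) G) x          ≈⟨ +-identityˡ _ ⟩
    evalDerivSum T (psumOver (allFin s) G) x               ≈⟨ evalDerivSum-psumOver T (allFin s) G x ⟩
    sumOver (allFin s) (λ m → evalDerivSum T (G m) x)      ≈⟨ sumOver-cong (allFin s) summand ⟩
    sumOver (allFin s) (λ m → fromℕ R (n m) * avec R α (minusE R α n m) j) ∎
    where
    open SetoidReasoning setoid
    T = total R α n
    f = fpoly R α n
    x = α j
    df : DegreeAtMost T f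
    df = degree-fList (allFin s) (λ _ → ℕ.≤-refl)
    G : Fin s → Poly R
    G m = fromℕ R (n m) · fpoly R α (minusE R α n m)
    summand : ∀ m → evalDerivSum T (G m) x ≈ fromℕ R (n m) * avec R α (minusE R α n m) j
    summand m = trans (evalDerivSum-· T (fromℕ R (n m)) _ x)
      (*-congˡ (sym (avec-evalDerivSum (minusE R α n m) j (degree-fpoly-minusE n m))))

  suc-minusE-≡ : ∀ n k → 1 ≤ n k → suc (minusE R α n k k) ≡ n k
  suc-minusE-≡ n k 1≤nk = ≡.trans (≡.cong suc (minusE-≡ n k)) (ℕ.m+[n∸m]≡n 1≤nk)

  minusE-plusE-≡ : ∀ n l k → 1 ≤ n k → Dec (l ≡ k) →
                   minusE R α (plusE R α n l) k l ≡ suc (minusE R α n k l)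
  minusE-plusE-≡ n l .l 1≤nl (yes ≡.refl) =
    ≡.trans (minusE-≡ (plusE R α n l) l) (≡.trans (≡.cong (_∸ 1) (plusE-≡ n l)) (≡.sym (suc-minusE-≡ n l 1≤nl)))
  minusE-plusE-≡ n l k 1≤nk (no l≢k) =
    ≡.trans (minusE-≢ (plusE R α n l) k l≢k) (≡.trans (plusE-≡ n l) (≡.cong suc (≡.sym (minusE-≢ n k l≢k))))

  fpoly-exchange : ∀ n l k → 1 ≤ n k →
    fpoly R α (minusE R α (plusE R α n l) k) ≋ fpoly R α n ⊕ (α k - α l) · fpoly R α (minusE R α n k)
  fpoly-exchange n l k 1≤nk = begin
    fList n' xs                                           ≈⟨ fList-raise (allFin⁺ s) (∈-allFin l) n'l≡ n'≡n⁻ ⟩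
    linear R (α l) ⊗ g                                    ≈⟨ ⊗-congˡ g (linear-shift (α k) (α l)) ⟩
    (linear R (α k) ⊕ (α k - α l) · pone R) ⊗ g            ≈⟨ ⊗-distribʳ (linear R (α k)) ((α k - α l) · pone R) g ⟩
    linear R (α k) ⊗ g ⊕ (α k - α l) · pone R ⊗ g          ≈⟨ ⊕-cong fk≋ (≋-trans (·-⊗ (α k - α l) (pone R) g)
                                                                (·-cong refl (⊗-identityˡ g))) ⟩
    fList n xs ⊕ (α k - α l) · g                          ∎
    where
    open SetoidReasoning ≋-setoid
    xs = allFin s
    n' = minusE R α (plusE R α n l) k
    n⁻ = minusE R α n k
    g = fList n⁻ xs

    nk≡ : n k ≡ suc (n⁻ k)
    nk≡ = ≡.sym (suc-minusE-≡ n k 1≤nk)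

    n'l≡ : n' l ≡ suc (n⁻ l)
    n'l≡ = minusE-plusE-≡ n l k 1≤nk (l ≟ k)

    n'≡n⁻ : ∀ z → z ≢ l → n' z ≡ n⁻ z
    n'≡n⁻ z z≢l = minusE-cong k z (plusE-≢ n l z≢l)

    fk≋ : linear R (α k) ⊗ g ≋ fList n xs
    fk≋ = ≋-sym (fList-raise (allFin⁺ s) (∈-allFin k) nk≡ (λ z z≢k → ≡.sym (minusE-≢ n k z≢k)))

  avec-exchange : ∀ n l k j → 1 ≤ n k →
    avec R α (minusE R α (plusE R α n l) k) j ≈ avec R α n j + (α k - α l) * avec R α (minusE R α n k) j
  avec-exchange n l k j 1≤nk = begin
    avec R α n' j                                   ≈⟨ avec-evalDerivSum n' j dh ⟩
    evalDerivSum T (fpoly R α n') x                 ≈⟨ evalDerivSum-cong T x (fpoly-exchange n l k 1≤nk) ⟩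
    evalDerivSum T (f ⊕ Δ · g) x                    ≈⟨ evalDerivSum-⊕ T f (Δ · g) x ⟩
    evalDerivSum T f x + evalDerivSum T (Δ · g) x   ≈⟨ +-congˡ (evalDerivSum-· T Δ g x) ⟩
    evalDerivSum T f x + Δ * evalDerivSum T g x     ≈⟨ +-cong (avec-evalDerivSum n j df) (*-congˡ (avec-evalDerivSum _ j dg)) ⟨
    avec R α n j + Δ * avec R α (minusE R α n k) j  ∎
    where
    open SetoidReasoning setoid
    T = total R α n
    x = α j
    Δ = α k - α l
    n' = minusE R α (plusE R α n l) k
    f = fpoly R α n
    g = fpoly R α (minusE R α n k)
    df : DegreeAtMost T f
    df = degree-fList (allFin s) (λ _ → ℕ.≤-refl)
    dg : DegreeAtMost T g
    dg = degree-fpoly-minusE n k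
    dh : DegreeAtMost T (fpoly R α n')
    dh = degree-cong (≋-sym (fpoly-exchange n l k 1≤nk)) (degree-⊕ df (degree-· dg))

  matMul-Mmat : ∀ n l (B : Fin s → Fin s → Carrier) k j →
    matMul R α (Mmat R α n l) B k j ≈ sumOver (allFin s) (λ m → fromℕ R (n m) * B m j) + (α k - α l) * B k j
  matMul-Mmat n l B k j = begin
    sumOver xs (λ m → (fromℕ R (n m) + δ R α k m * Δ) * B m j)                ≈⟨ sumOver-cong xs expand ⟩
    sumOver xs (λ m → fromℕ R (n m) * B m j + δ R α k m * (Δ * B m j))       ≈⟨ sumOver-+ xs _ _ ⟩
    sumOver xs (λ m → fromℕ R (n m) * B m j) + sumOver xs (λ m → δ R α k m * (Δ * B m j))
                                                                             ≈⟨ +-congˡ diagonal ⟩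
    sumOver xs (λ m → fromℕ R (n m) * B m j) + Δ * B k j                     ∎
    where
    open SetoidReasoning setoid
    xs = allFin s
    Δ = α k - α l
    expand : ∀ m → (fromℕ R (n m) + δ R α k m * Δ) * B m j ≈ fromℕ R (n m) * B m j + δ R α k m * (Δ * B m j)
    expand m = trans (distribʳ _ _ _) (+-congˡ (*-assoc _ _ _))
    diagonal : sumOver xs (λ m → δ R α k m * (Δ * B m j)) ≈ Δ * B k j
    diagonal = trans (sumOver-indicator (allFin⁺ s) (∈-allFin k)
                        (λ m m≢k → trans (*-congʳ (δ-≢ (≡.≢-sym m≢k))) (zeroˡ _)))
                     (trans (*-congʳ (δ-≡ k)) (*-identityˡ _))

open NodeProducts

corollaryA2 : ∀ {c ℓ} (R : CommutativeRing c ℓ) (s : ℕ) (α : Fin s → CommutativeRing.Carrier R)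
    → (∀ i j → i ≢ j → ¬ (CommutativeRing._≈_ R (α i) (α j)))
    → (n : Fin s → ℕ) → (∀ i → 1 ≤ n i) → (l : Fin s)
    → ∀ k j → CommutativeRing._≈_ R (Amat R α (plusE R α n l) k j) (matMul R α (Mmat R α n l) (Amat R α n) k j)
corollaryA2 R s α _ n 1≤n l k j = begin
  avec R α (minusE R α (plusE R α n l) k) j                             ≈⟨ avec-exchange R α n l k j (1≤n k) ⟩
  avec R α n j + Δ * Amat R α n k j                                     ≈⟨ +-congʳ (avec-recurrence R α n j (1≤n j)) ⟩
  sumOver (allFin s) (λ m → fromℕ R (n m) * Amat R α n m j) + Δ * Amat R α n k j
                                                                        ≈⟨ matMul-Mmat R α n l (Amat R α n) k j ⟨
  matMul R α (Mmat R α n l) (Amat R α n) k j                            ∎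
  where
  open CommutativeRing R
  open Polynomials R using (sumOver)
  open SetoidReasoning setoid
  Δ = α k - α l
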